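{- Let $r,s\ge0$ be integers. For each $1\le i\le r$ let $p_i$ be a prime with $p_i=a_i^2+b_i^2\equiv 1\pmod 8$ for integers $a_i,b_i$ such that both $a_i+b_i$ and $a_i-b_i$ lie in $\{8m\pm1\mid m\in\mathbb{Z}\}$; let $p_{r+1},\dots,p_{r+s}$ be primes congruent to $7$ modulo $8$; and let $k_1,\dots,k_{r+s}$ be non-negative integers. If $\alpha\in\mathbb{Z}[\sqrt{ -1}]$ satisfies $$\alpha\overline{\alpha}=2\,p_1^{k_1}\cdots p_r^{k_r}\,p_{r+1}^{2k_{r+1}}\cdots p_{r+s}^{2k_{r+s}},$$ then $\Re(\alpha),\Im(\alpha)\in\{8m\pm1\mid m\in\mathbb{Z}\}$.
   Context: $\overline{\alpha}$ denotes the complex conjugate of $\alpha$. -}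

module Defs where

open import Data.Nat as ℕ using (ℕ; zero; suc)
open import Data.Integer as ℤ using (ℤ; +_; _+_; _-_; _*_; -_)
open import Data.Fin using (Fin; zero; suc)
open import Data.Product using (∃; _,_)
open import Data.Sum using (_⊎_)
open import Relation.Binary.PropositionalEquality using (_≡_)

record ℤ[i] : Set where
  constructor gauss
  field
    re : ℤ
    im : ℤ
open ℤ[i] public

_*ᵍ_ : ℤ[i] → ℤ[i] → ℤ[i]
gauss a b *ᵍ gauss c d = gauss ((a * c) - (b * d)) ((a * d) + (b * c))

conj : ℤ[i] → ℤ[i]
conj (gauss a b) = gauss a (- b)

fromℕ : ℕ → ℤ[i]
fromℕ n = gauss (+ n) (+ 0)

EightMPm1 : ℤ → Set
EightMPm1 x = ∃ λ (m : ℤ) → (x ≡ (+ 8 * m) + + 1) ⊎ (x ≡ (+ 8 * m) - + 1)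

∏ : (n : ℕ) → (Fin n → ℕ) → ℕ
∏ zero f = 1
∏ (suc n) f = f zero ℕ.* ∏ n (λ i → f (suc i))

{-# OPTIONS --safe #-}
-- Call M good (NormTwice⇒EightMPm1ᵍ M) if every Gaussian integer z with N(z) = 2M has both
-- coordinates ≡ ±1 (mod 8).
-- M = 1 is good, as x² + y² = 2 forces x, y = ±1. If M is good and p = N(π) with π = a + bi
-- as in the statement, then p M is good: p divides re(z π̄) re(z π), so z = w π or z = w π̄
-- with N(w) = 2M, and modulo 8 the coordinates of w π are ±(a ± b). If q ≡ 7 (mod 8) is
-- prime then q² M is good: −1 is not a square modulo q, so q divides z, and z / q has norm 2M
-- while multiplication by q ≡ −1 (mod 8) preserves ±1 (mod 8).
module Submission where

open import Defs
open import Data.Nat as ℕ using (ℕ; zero; suc; _%_; _^_; _!; _∸_; _≤_; _<_; z≤n; s≤s)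
import Data.Nat.Properties as ℕ
import Data.Nat.Divisibility as ℕ
open import Data.Nat.DivMod using (m≡m%n+[m/n]*n; m∣n⇒o%n%m≡o%m; m/n*n≡m)
open import Data.Nat.Combinatorics using (_C_; nCn≡1; k![n∸k]!∣n!)
open import Data.Nat.Combinatorics.Specification using (nCk≡n!/k![n-k]!)
open import Data.Nat.Primality using (Prime; euclidsLemma; prime⇒nonZero; ¬prime[0]; ¬prime[1])
import Data.Nat.Tactic.RingSolver as ℕ-Solver
open import Data.Integer as ℤ using (ℤ; +_; -[1+_]; _+_; _-_; _*_; -_; 0ℤ; 1ℤ)
import Data.Integer.Properties as ℤ
open import Data.Integer.Divisibility.Signed
open import Data.Integer.Tactic.RingSolver using (solve-∀)
open import Data.Fin as Fin using (Fin; toℕ; inject₁)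
import Data.Fin.Properties as Fin
open import Data.Product using (∃; _,_; _×_; proj₁; proj₂)
open import Data.Sum using (_⊎_; inj₁; inj₂; [_,_]′)
open import Function using (_∘_)
open import Relation.Nullary using (¬_; yes; no; contradiction)
open import Relation.Binary.PropositionalEquality
open ≡-Reasoning

open import Algebra.Properties.CommutativeSemiring.Binomial ℤ.+-*-commutativeSemiring as Binomial
  using (binomialTerm)
open import Algebra.Properties.Semiring.Sum ℤ.+-*-semiring using (sum; sum-init-last)
import Algebra.Definitions.RawSemiring ℤ.+-*-rawSemiring as Raw

euclidsLemmaℤ : ∀ {p} → Prime p → ∀ x y → + p ∣ x * y → + p ∣ x ⊎ + p ∣ y
euclidsLemmaℤ p-prime x y p∣xy
  with euclidsLemma ℤ.∣ x ∣ ℤ.∣ y ∣ p-prime (subst (ℕ._∣_ _) (ℤ.abs-* x y) (∣⇒∣ᵤ p∣xy))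
... | inj₁ p∣x = inj₁ (∣ᵤ⇒∣ p∣x)
... | inj₂ p∣y = inj₂ (∣ᵤ⇒∣ p∣y)

prime∣square⇒∣ : ∀ {p} → Prime p → ∀ x → + p ∣ x * x → + p ∣ x
prime∣square⇒∣ p-prime x p∣xx with euclidsLemmaℤ p-prime x x p∣xx
... | inj₁ p∣x = p∣x
... | inj₂ p∣x = p∣x

prime∣n!⇒≤ : ∀ {p} → Prime p → ∀ n → p ℕ.∣ n ! → p ≤ n
prime∣n!⇒≤ p-prime zero p∣1 = contradiction (subst Prime (ℕ.∣1⇒≡1 p∣1) p-prime) ¬prime[1]
prime∣n!⇒≤ p-prime (suc n) p∣n! with euclidsLemma (suc n) (n !) p-prime p∣n!
... | inj₁ p∣1+n = ℕ.∣⇒≤ p∣1+n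
... | inj₂ p∣n!  = ℕ.m≤n⇒m≤1+n (prime∣n!⇒≤ p-prime n p∣n!)

prime∣pCk : ∀ {p k} → Prime p → 0 < k → k < p → p ℕ.∣ p C k
prime∣pCk {suc m} {k} p-prime 0<k k<p
  with euclidsLemma (suc m C k) (k ! ℕ.* (suc m ∸ k) !) p-prime
         (subst (ℕ._∣_ (suc m)) (sym C*k![p∸k]!≡p!) (ℕ.m∣m*n (m !)))
  where
  C*k![p∸k]!≡p! : (suc m C k) ℕ.* (k ! ℕ.* (suc m ∸ k) !) ≡ suc m !
  C*k![p∸k]!≡p! = trans (cong (ℕ._* (k ! ℕ.* (suc m ∸ k) !)) (nCk≡n!/k![n-k]! (ℕ.<⇒≤ k<p)))
                        (m/n*n≡m {{ℕ._!*_!≢0 k (suc m ∸ k)}} (k![n∸k]!∣n! (ℕ.<⇒≤ k<p)))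
... | inj₁ p∣C = p∣C
... | inj₂ p∣k![p∸k]! with euclidsLemma (k !) ((suc m ∸ k) !) p-prime p∣k![p∸k]!
...   | inj₁ p∣k! = contradiction (prime∣n!⇒≤ p-prime k p∣k!) (ℕ.<⇒≱ k<p)
...   | inj₂ p∣[p∸k]! =
  contradiction (prime∣n!⇒≤ p-prime _ p∣[p∸k]!) (ℕ.<⇒≱ (ℕ.∸-monoʳ-< 0<k (ℕ.<⇒≤ k<p)))

×≡* : ∀ n x → n Raw.× x ≡ + n * x
×≡* zero x = sym (ℤ.*-zeroˡ x)
×≡* (suc n) x = trans (cong (_+_ x) (×≡* n x)) (sym (ℤ.suc-* (+ n) x))

^≡^ : ∀ x n → x Raw.^ n ≡ x ℤ.^ n
^≡^ x zero = refl
^≡^ x (suc n) = cong (x *_) (^≡^ x n)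

∣n⇒∣n×x : ∀ {d n} x → d ℕ.∣ n → + d ∣ n Raw.× x
∣n⇒∣n×x {n = n} x d∣n = subst (_ ∣_) (sym (×≡* n x)) (∣m⇒∣m*n {m = + n} x (∣ᵤ⇒∣ d∣n))

∣-sum : ∀ {d} n (f : Fin n → ℤ) → (∀ i → d ∣ f i) → d ∣ sum f
∣-sum zero f d∣f = divides 0ℤ refl
∣-sum (suc n) f d∣f = ∣m∣n⇒∣m+n (d∣f Fin.zero) (∣-sum n (f ∘ Fin.suc) (d∣f ∘ Fin.suc))

prime∣[x+y]^p-[x^p+y^p] : ∀ {p} → Prime p → ∀ x y → + p ∣ (x + y) ℤ.^ p - (x ℤ.^ p + y ℤ.^ p)
prime∣[x+y]^p-[x^p+y^p] {zero} p-prime = contradiction p-prime ¬prime[0]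
prime∣[x+y]^p-[x^p+y^p] {suc m} p-prime x y = subst (+ p ∣_) (sym expand) (∣-sum m inner p∣inner)
  where
  p : ℕ
  p = suc m
  T : Fin (suc p) → ℤ
  T = binomialTerm x y p
  inner : Fin m → ℤ
  inner i = T (Fin.suc (inject₁ i))
  p∣inner : ∀ i → + p ∣ inner i
  p∣inner i = ∣n⇒∣n×x (Binomial.binomial x y p (Fin.suc (inject₁ i)))
                       (prime∣pCk p-prime (s≤s z≤n) (s≤s i<m))
    where
    i<m : toℕ (inject₁ i) < m
    i<m = subst (_< m) (sym (Fin.toℕ-inject₁ i)) (Fin.toℕ<n i)
  first : T Fin.zero ≡ y ℤ.^ p
  first = trans (ℤ.+-identityʳ _) (trans (ℤ.*-identityˡ _) (^≡^ y p))
  last : T (Fin.suc (Fin.fromℕ m)) ≡ x ℤ.^ p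
  last = begin
    T (Fin.suc (Fin.fromℕ m))
      ≡⟨ cong (λ j → (p C j) Raw.× (x Raw.^ j * y Raw.^ (p ∸ j))) (cong suc (Fin.toℕ-fromℕ m)) ⟩
    (p C p) Raw.× (x Raw.^ p * y Raw.^ (p ∸ p))
      ≡⟨ cong₂ (λ c e → c Raw.× (x Raw.^ p * y Raw.^ e)) (nCn≡1 p) (ℕ.n∸n≡0 p) ⟩
    x Raw.^ p * 1ℤ + 0ℤ
      ≡⟨ trans (ℤ.+-identityʳ _) (ℤ.*-identityʳ _) ⟩
    x Raw.^ p
      ≡⟨ ^≡^ x p ⟩
    x ℤ.^ p ∎
  xᵖ+yᵖ : ℤ
  xᵖ+yᵖ = x ℤ.^ p + y ℤ.^ p
  expand : (x + y) ℤ.^ p - xᵖ+yᵖ ≡ sum inner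
  expand = begin
    (x + y) ℤ.^ p - xᵖ+yᵖ
      ≡⟨ cong (_- xᵖ+yᵖ) (trans (sym (^≡^ (x + y) p)) (Binomial.theorem p x y)) ⟩
    T Fin.zero + sum (T ∘ Fin.suc) - xᵖ+yᵖ
      ≡⟨ cong (λ t → T Fin.zero + t - xᵖ+yᵖ) (sum-init-last (T ∘ Fin.suc)) ⟩
    T Fin.zero + (sum inner + T (Fin.suc (Fin.fromℕ m))) - xᵖ+yᵖ
      ≡⟨ cong₂ (λ u v → u + (sum inner + v) - xᵖ+yᵖ) first last ⟩
    y ℤ.^ p + (sum inner + x ℤ.^ p) - xᵖ+yᵖ
      ≡⟨ cancel (x ℤ.^ p) (y ℤ.^ p) (sum inner) ⟩
    sum inner ∎
    where
    cancel : ∀ a b s → b + (s + a) - (a + b) ≡ s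
    cancel = solve-∀

prime∣n^p-n : ∀ {p} → Prime p → ∀ n → + p ∣ (+ n) ℤ.^ p - + n
prime∣n^p-n {zero} p-prime = contradiction p-prime ¬prime[0]
prime∣n^p-n {suc m} p-prime zero = divides 0ℤ refl
prime∣n^p-n {p@(suc m)} p-prime (suc n) =
  subst (+ p ∣_) (sym (split ((1ℤ + + n) ℤ.^ p) ((+ n) ℤ.^ p) (1ℤ ℤ.^ p) (+ n)))
    (∣m∣n⇒∣m+n (∣m∣n⇒∣m+n (prime∣[x+y]^p-[x^p+y^p] p-prime 1ℤ (+ n)) (prime∣n^p-n p-prime n))
               (subst (λ u → + p ∣ u - 1ℤ) (sym (ℤ.^-zeroˡ p)) (divides 0ℤ refl)))
  where
  split : ∀ s t u n → s - (1ℤ + n) ≡ s - (u + t) + (t - n) + (u - 1ℤ)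
  split = solve-∀

-- For negative x, use (x + (−x))ᵖ = 0 to reduce to −x.
prime∣x^p-x : ∀ {p} → Prime p → ∀ x → + p ∣ x ℤ.^ p - x
prime∣x^p-x p-prime (+ n) = prime∣n^p-n p-prime n
prime∣x^p-x {zero} p-prime -[1+ n ] = contradiction p-prime ¬prime[0]
prime∣x^p-x {p@(suc m)} p-prime x@(-[1+ n ]) =
  subst (+ p ∣_) (sym (split ((x + - x) ℤ.^ p) (x ℤ.^ p) ((- x) ℤ.^ p) x))
    (∣m∣n⇒∣m-n (∣m∣n⇒∣m-n p∣0^p (prime∣[x+y]^p-[x^p+y^p] p-prime x (- x))) (prime∣n^p-n p-prime (suc n)))
  where
  p∣0^p : + p ∣ (x + - x) ℤ.^ p
  p∣0^p = subst (λ u → + p ∣ u ℤ.^ p) (sym (ℤ.+-inverseʳ x)) (divides 0ℤ refl)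
  split : ∀ s t u x → t - x ≡ s - (s - (t + u)) - (u - - x)
  split = solve-∀

fermatsLittleTheorem : ∀ {n} → Prime (suc n) → ∀ {x} → ¬ + suc n ∣ x → + suc n ∣ x ℤ.^ n - 1ℤ
fermatsLittleTheorem {n} p-prime {x} p∤x with euclidsLemmaℤ p-prime x (x ℤ.^ n - 1ℤ)
  (subst (+ suc n ∣_) (factor x (x ℤ.^ n)) (prime∣x^p-x p-prime x))
  where
  factor : ∀ x t → x * t - x ≡ x * (t - 1ℤ)
  factor = solve-∀
... | inj₁ p∣x = contradiction p∣x p∤x
... | inj₂ p∣x^n-1 = p∣x^n-1

^-cong-∣ : ∀ {k} a b n → k ∣ a - b → k ∣ a ℤ.^ n - b ℤ.^ n
^-cong-∣ a b zero k∣a-b = divides 0ℤ refl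
^-cong-∣ a b (suc n) k∣a-b = subst (_ ∣_) (sym (factor a b (a ℤ.^ n) (b ℤ.^ n)))
  (∣m∣n⇒∣m+n (∣n⇒∣m*n a (^-cong-∣ a b n k∣a-b)) (∣m⇒∣m*n (b ℤ.^ n) k∣a-b))
  where
  factor : ∀ a b s t → a * s - b * t ≡ a * (s - t) + (a - b) * t
  factor = solve-∀

neg*neg : ∀ x → - x * - x ≡ x * x
neg*neg = solve-∀

^-even : ∀ x e → x ℤ.^ (2 ℕ.* e) ≡ (x * x) ℤ.^ e
^-even x e = trans (sym (ℤ.^-*-assoc x 2 e)) (cong (λ t → (x * t) ℤ.^ e) (ℤ.*-identityʳ x))

neg-^-odd : ∀ w d → (- w) ℤ.^ suc (2 ℕ.* d) ≡ - w ℤ.^ suc (2 ℕ.* d)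
neg-^-odd w d = begin
  (- w) * (- w) ℤ.^ (2 ℕ.* d)    ≡⟨ cong ((- w) *_) (^-even (- w) d) ⟩
  (- w) * (- w * - w) ℤ.^ d      ≡⟨ cong (λ t → (- w) * t ℤ.^ d) (neg*neg w) ⟩
  (- w) * (w * w) ℤ.^ d          ≡⟨ cong ((- w) *_) (sym (^-even w d)) ⟩
  (- w) * w ℤ.^ (2 ℕ.* d)        ≡⟨ sym (ℤ.neg-distribˡ-* w _) ⟩
  - w ℤ.^ suc (2 ℕ.* d)          ∎

%4≡3⇒≡3+4* : ∀ q → q % 4 ≡ 3 → ∃ λ d → q ≡ 3 ℕ.+ 4 ℕ.* d
%4≡3⇒≡3+4* q q%4≡3 = q ℕ./ 4 , trans (m≡m%n+[m/n]*n q 4)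
  (trans (cong (ℕ._+ q ℕ./ 4 ℕ.* 4) q%4≡3) (cong (3 ℕ.+_) (ℕ.*-comm (q ℕ./ 4) 4)))

-- If q ∤ x then q ∤ y and y² ≡ −x²; with q = 2e + 1, Fermat gives (x²)ᵉ ≡ (y²)ᵉ ≡ 1, while e is odd,
-- so (y²)ᵉ ≡ −(x²)ᵉ. Hence q ∣ 2.
prime≡3mod4∣x²+y²⇒∣x : ∀ {q} → Prime q → q % 4 ≡ 3 → ∀ x y → + q ∣ x * x + y * y → + q ∣ x
prime≡3mod4∣x²+y²⇒∣x {q} q-prime q%4≡3 x y q∣x²+y² with %4≡3⇒≡3+4* q q%4≡3
... | d , refl with + (3 ℕ.+ 4 ℕ.* d) ∣? x
...   | yes q∣x = q∣x
...   | no  q∤x = contradiction (ℕ.∣⇒≤ (∣⇒∣ᵤ q∣2)) λ { (s≤s (s≤s ())) }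
  where
  e : ℕ
  e = suc (2 ℕ.* d)
  Q : ℤ
  Q = + (3 ℕ.+ 4 ℕ.* d)
  q∤y : ¬ Q ∣ y
  q∤y q∣y = q∤x (prime∣square⇒∣ q-prime x (∣m+n∣n⇒∣m q∣x²+y² (∣m⇒∣m*n y q∣y)))
  fermat-on-square : ∀ {u} → ¬ Q ∣ u → Q ∣ (u * u) ℤ.^ e - 1ℤ
  fermat-on-square {u} q∤u = subst (λ t → Q ∣ t - 1ℤ) (trans (cong (u ℤ.^_) (2+4d≡2[1+2d] d)) (^-even u e))
    (fermatsLittleTheorem q-prime q∤u)
    where
    2+4d≡2[1+2d] : ∀ d → 2 ℕ.+ 4 ℕ.* d ≡ 2 ℕ.* (1 ℕ.+ 2 ℕ.* d)
    2+4d≡2[1+2d] = ℕ-Solver.solve-∀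
  q∣y²ᵉ+x²ᵉ : Q ∣ (y * y) ℤ.^ e + (x * x) ℤ.^ e
  q∣y²ᵉ+x²ᵉ = subst (Q ∣_) odd-power (^-cong-∣ (y * y) (- (x * x)) e (subst (Q ∣_) (swap x y) q∣x²+y²))
    where
    odd-power : (y * y) ℤ.^ e - (- (x * x)) ℤ.^ e ≡ (y * y) ℤ.^ e + (x * x) ℤ.^ e
    odd-power = trans (cong (λ t → (y * y) ℤ.^ e - t) (neg-^-odd (x * x) d))
                      (cong (λ t → (y * y) ℤ.^ e + t) (ℤ.neg-involutive ((x * x) ℤ.^ e)))
    swap : ∀ x y → x * x + y * y ≡ y * y - - (x * x)
    swap = solve-∀
  q∣2 : Q ∣ + 2
  q∣2 = subst (Q ∣_) (two ((x * x) ℤ.^ e) ((y * y) ℤ.^ e))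
    (∣m∣n⇒∣m-n (∣m∣n⇒∣m-n q∣y²ᵉ+x²ᵉ (fermat-on-square q∤y)) (fermat-on-square q∤x))
    where
    two : ∀ a b → b + a - (b - 1ℤ) - (a - 1ℤ) ≡ + 2
    two = solve-∀

EightMPm1-+8* : ∀ {z} → EightMPm1 z → ∀ t → EightMPm1 (z + + 8 * t)
EightMPm1-+8* (m , inj₁ refl) t = m + t , inj₁ (shift m t)
  where
  shift : ∀ m t → + 8 * m + 1ℤ + + 8 * t ≡ + 8 * (m + t) + 1ℤ
  shift = solve-∀
EightMPm1-+8* (m , inj₂ refl) t = m + t , inj₂ (shift m t)
  where
  shift : ∀ m t → + 8 * m - 1ℤ + + 8 * t ≡ + 8 * (m + t) - 1ℤ
  shift = solve-∀

EightMPm1-neg : ∀ {z} → EightMPm1 z → EightMPm1 (- z)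
EightMPm1-neg (m , inj₁ refl) = - m , inj₂ (negate m)
  where
  negate : ∀ m → - (+ 8 * m + 1ℤ) ≡ + 8 * (- m) - 1ℤ
  negate = solve-∀
EightMPm1-neg (m , inj₂ refl) = - m , inj₁ (negate m)
  where
  negate : ∀ m → - (+ 8 * m - 1ℤ) ≡ + 8 * (- m) + 1ℤ
  negate = solve-∀

EightMPm1-*-[8m-1] : ∀ {u} m → EightMPm1 u → EightMPm1 (u * (+ 8 * m - 1ℤ))
EightMPm1-*-[8m-1] {u} m u∈ = subst EightMPm1 (sym (expand u m)) (EightMPm1-+8* (EightMPm1-neg u∈) (u * m))
  where
  expand : ∀ u m → u * (+ 8 * m - 1ℤ) ≡ - u + + 8 * (u * m)
  expand = solve-∀

-- Modulo 8, u and v are ±1, so u a − v b is ±(a − b) or ±(a + b).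
EightMPm1-twist : ∀ {u v a b} → EightMPm1 u → EightMPm1 v → EightMPm1 (a + b) → EightMPm1 (a - b)
                → EightMPm1 (u * a - v * b)
EightMPm1-twist {a = a} {b} (m , inj₁ refl) (n , inj₁ refl) a+b∈ a-b∈ =
  subst EightMPm1 (expand m n a b) (EightMPm1-+8* a-b∈ (m * a - n * b))
  where
  expand : ∀ m n a b → a - b + + 8 * (m * a - n * b) ≡ (+ 8 * m + 1ℤ) * a - (+ 8 * n + 1ℤ) * b
  expand = solve-∀
EightMPm1-twist {a = a} {b} (m , inj₁ refl) (n , inj₂ refl) a+b∈ a-b∈ =
  subst EightMPm1 (expand m n a b) (EightMPm1-+8* a+b∈ (m * a - n * b))
  where
  expand : ∀ m n a b → a + b + + 8 * (m * a - n * b) ≡ (+ 8 * m + 1ℤ) * a - (+ 8 * n - 1ℤ) * b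
  expand = solve-∀
EightMPm1-twist {a = a} {b} (m , inj₂ refl) (n , inj₁ refl) a+b∈ a-b∈ =
  subst EightMPm1 (expand m n a b) (EightMPm1-+8* (EightMPm1-neg a+b∈) (m * a - n * b))
  where
  expand : ∀ m n a b → - (a + b) + + 8 * (m * a - n * b) ≡ (+ 8 * m - 1ℤ) * a - (+ 8 * n + 1ℤ) * b
  expand = solve-∀
EightMPm1-twist {a = a} {b} (m , inj₂ refl) (n , inj₂ refl) a+b∈ a-b∈ =
  subst EightMPm1 (expand m n a b) (EightMPm1-+8* (EightMPm1-neg a-b∈) (m * a - n * b))
  where
  expand : ∀ m n a b → - (a - b) + + 8 * (m * a - n * b) ≡ (+ 8 * m - 1ℤ) * a - (+ 8 * n - 1ℤ) * b
  expand = solve-∀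

norm : ℤ[i] → ℤ
norm z = re z * re z + im z * im z

_·ᵍ_ : ℤ[i] → ℤ → ℤ[i]
z ·ᵍ k = gauss (re z * k) (im z * k)

conj-involutive : ∀ z → conj (conj z) ≡ z
conj-involutive (gauss x y) = cong (gauss x) (ℤ.neg-involutive y)

norm-conj : ∀ z → norm (conj z) ≡ norm z
norm-conj (gauss x y) = cong (_+_ (x * x)) (neg*neg y)

re-*ᵍ-conj : ∀ z → re (z *ᵍ conj z) ≡ norm z
re-*ᵍ-conj (gauss x y) = identity x y
  where
  identity : ∀ x y → x * x - y * (- y) ≡ x * x + y * y
  identity = solve-∀

norm-*ᵍ : ∀ z w → norm (z *ᵍ w) ≡ norm z * norm w
norm-*ᵍ (gauss x y) (gauss a b) = identity x y a b
  where
  identity : ∀ x y a b → (x * a - y * b) * (x * a - y * b) + (x * b + y * a) * (x * b + y * a)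
                       ≡ (x * x + y * y) * (a * a + b * b)
  identity = solve-∀

norm-·ᵍ : ∀ z k → norm (z ·ᵍ k) ≡ norm z * (k * k)
norm-·ᵍ (gauss x y) k = identity x y k
  where
  identity : ∀ x y k → x * k * (x * k) + y * k * (y * k) ≡ (x * x + y * y) * (k * k)
  identity = solve-∀

*ᵍ-conj-*ᵍ : ∀ z w → (z *ᵍ conj w) *ᵍ w ≡ z ·ᵍ norm w
*ᵍ-conj-*ᵍ (gauss x y) (gauss a b) = cong₂ gauss (identityʳ x y a b) (identityⁱ x y a b)
  where
  identityʳ : ∀ x y a b → (x * a - y * (- b)) * a - (x * (- b) + y * a) * b ≡ x * (a * a + b * b)
  identityʳ = solve-∀
  identityⁱ : ∀ x y a b → (x * a - y * (- b)) * b + (x * (- b) + y * a) * a ≡ y * (a * a + b * b)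
  identityⁱ = solve-∀

·ᵍ-*ᵍ : ∀ z w k → (z ·ᵍ k) *ᵍ w ≡ (z *ᵍ w) ·ᵍ k
·ᵍ-*ᵍ (gauss x y) (gauss a b) k = cong₂ gauss (identityʳ x y a b k) (identityⁱ x y a b k)
  where
  identityʳ : ∀ x y a b k → x * k * a - y * k * b ≡ (x * a - y * b) * k
  identityʳ = solve-∀
  identityⁱ : ∀ x y a b k → x * k * b + y * k * a ≡ (x * b + y * a) * k
  identityⁱ = solve-∀

·ᵍ-cancelʳ : ∀ {z w} k .{{_ : ℤ.NonZero k}} → z ·ᵍ k ≡ w ·ᵍ k → z ≡ w
·ᵍ-cancelʳ {z} {w} k eq =
  cong₂ gauss (ℤ.*-cancelʳ-≡ (re z) (re w) k (cong re eq)) (ℤ.*-cancelʳ-≡ (im z) (im w) k (cong im eq))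

∣re∧∣im⇒·ᵍ : ∀ {k z} → k ∣ re z → k ∣ im z → ∃ λ w → z ≡ w ·ᵍ k
∣re∧∣im⇒·ᵍ k∣re k∣im = gauss (quotient k∣re) (quotient k∣im) , cong₂ gauss (equality k∣re) (equality k∣im)
  where open _∣_

re-*ᵍ-conj-*-re-*ᵍ : ∀ z π → re (z *ᵍ conj π) * re (z *ᵍ π) ≡ re π * re π * norm z - im z * im z * norm π
re-*ᵍ-conj-*-re-*ᵍ (gauss x y) (gauss a b) = identity x y a b
  where
  identity : ∀ x y a b → (x * a - y * (- b)) * (x * a - y * b)
                       ≡ a * a * (x * x + y * y) - y * y * (a * a + b * b)
  identity = solve-∀

-- p ∣ N(z π̄) = N(z) p, so p ∣ re(z π̄) forces p ∣ im(z π̄); then z p = (z π̄) π = p (w π).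
prime-norm∣⇒∣ : ∀ {p} π z → Prime p → + p ≡ norm π → + p ∣ re (z *ᵍ conj π) → ∃ λ w → z ≡ w *ᵍ π
prime-norm∣⇒∣ {p} π z p-prime p≡Nπ p∣re = w , ·ᵍ-cancelʳ (+ p) {{prime⇒nonZero p-prime}} (begin
  z ·ᵍ (+ p)               ≡⟨ cong (z ·ᵍ_) p≡Nπ ⟩
  z ·ᵍ norm π              ≡⟨ sym (*ᵍ-conj-*ᵍ z π) ⟩
  (z *ᵍ conj π) *ᵍ π       ≡⟨ cong (_*ᵍ π) c≡w·p ⟩
  (w ·ᵍ (+ p)) *ᵍ π        ≡⟨ ·ᵍ-*ᵍ w π (+ p) ⟩
  (w *ᵍ π) ·ᵍ (+ p)        ∎)
  where
  c : ℤ[i]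
  c = z *ᵍ conj π
  p∣Nc : + p ∣ norm c
  p∣Nc = subst (+ p ∣_) (sym (trans (norm-*ᵍ z (conj π)) (cong (norm z *_) (trans (norm-conj π) (sym p≡Nπ)))))
           (∣n⇒∣m*n (norm z) ∣-refl)
  p∣im : + p ∣ im c
  p∣im = prime∣square⇒∣ p-prime (im c) (∣m+n∣m⇒∣n p∣Nc (∣m⇒∣m*n (re c) p∣re))
  w : ℤ[i]
  w = proj₁ (∣re∧∣im⇒·ᵍ p∣re p∣im)
  c≡w·p : c ≡ w ·ᵍ (+ p)
  c≡w·p = proj₂ (∣re∧∣im⇒·ᵍ p∣re p∣im)

EightMPm1ᵍ : ℤ[i] → Set
EightMPm1ᵍ z = EightMPm1 (re z) × EightMPm1 (im z)

EightMPm1ᵍ-*ᵍ : ∀ {w} π → EightMPm1ᵍ w → EightMPm1 (re π + im π) → EightMPm1 (re π - im π)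
              → EightMPm1ᵍ (w *ᵍ π)
EightMPm1ᵍ-*ᵍ {gauss u v} (gauss a b) (u∈ , v∈) a+b∈ a-b∈ =
  EightMPm1-twist u∈ v∈ a+b∈ a-b∈ ,
  subst EightMPm1 (swap u v a b) (EightMPm1-twist v∈ (EightMPm1-neg u∈) a+b∈ a-b∈)
  where
  swap : ∀ u v a b → v * a - (- u) * b ≡ u * b + v * a
  swap = solve-∀

NormTwice⇒EightMPm1ᵍ : ℕ → Set
NormTwice⇒EightMPm1ᵍ M = ∀ z → norm z ≡ + (2 ℕ.* M) → EightMPm1ᵍ z

ScalesBy : (ℕ → Set) → ℕ → Set
ScalesBy P c = ∀ M → P M → P (c ℕ.* M)

scalesBy-^ : ∀ {P c} → ScalesBy P c → ∀ k → ScalesBy P (c ^ k)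
scalesBy-^ {P} P-c zero M pM = subst P (sym (ℕ.+-identityʳ M)) pM
scalesBy-^ {P} {c} P-c (suc k) M pM =
  subst P (sym (ℕ.*-assoc c (c ^ k) M)) (P-c (c ^ k ℕ.* M) (scalesBy-^ {P} P-c k M pM))

scalesBy-∏ : ∀ {P} n (f : Fin n → ℕ) → (∀ i → ScalesBy P (f i)) → ScalesBy P (∏ n f)
scalesBy-∏ {P} zero f P-f M pM = subst P (sym (ℕ.+-identityʳ M)) pM
scalesBy-∏ {P} (suc n) f P-f M pM =
  subst P (sym (ℕ.*-assoc (f Fin.zero) _ M))
    (P-f Fin.zero _ (scalesBy-∏ n (f ∘ Fin.suc) (P-f ∘ Fin.suc) M pM))

+[2*[c*M]]≡+[2*M]*+c : ∀ c M → + (2 ℕ.* (c ℕ.* M)) ≡ + (2 ℕ.* M) * + c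
+[2*[c*M]]≡+[2*M]*+c c M = trans (cong +_ (reorder c M)) (ℤ.pos-* (2 ℕ.* M) c)
  where
  reorder : ∀ c M → 2 ℕ.* (c ℕ.* M) ≡ 2 ℕ.* M ℕ.* c
  reorder = ℕ-Solver.solve-∀

∣x∣≡1⇒EightMPm1 : ∀ {x} → ℤ.∣ x ∣ ≡ 1 → EightMPm1 x
∣x∣≡1⇒EightMPm1 {+ _} refl = 0ℤ , inj₁ refl
∣x∣≡1⇒EightMPm1 { -[1+ _ ]} refl = 0ℤ , inj₂ refl

4≤[2+k]² : ∀ k → 4 ≤ (2 ℕ.+ k) ℕ.* (2 ℕ.+ k)
4≤[2+k]² k = ℕ.*-mono-≤ {2} {2 ℕ.+ k} (s≤s (s≤s z≤n)) (s≤s (s≤s z≤n))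

4≰2 : ¬ 4 ≤ 2
4≰2 (s≤s (s≤s ()))

m²+n²≡2⇒≡1 : ∀ m n → m ℕ.* m ℕ.+ n ℕ.* n ≡ 2 → m ≡ 1 × n ≡ 1
m²+n²≡2⇒≡1 0 0 ()
m²+n²≡2⇒≡1 0 1 ()
m²+n²≡2⇒≡1 1 0 ()
m²+n²≡2⇒≡1 1 1 _ = refl , refl
m²+n²≡2⇒≡1 (suc (suc m)) n eq =
  contradiction (ℕ.≤-trans (4≤[2+k]² m) (ℕ.≤-trans (ℕ.m≤m+n _ (n ℕ.* n)) (ℕ.≤-reflexive eq))) 4≰2
m²+n²≡2⇒≡1 m (suc (suc n)) eq =
  contradiction (ℕ.≤-trans (4≤[2+k]² n) (ℕ.≤-trans (ℕ.m≤n+m _ (m ℕ.* m)) (ℕ.≤-reflexive eq))) 4≰2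

square-abs : ∀ x → + (ℤ.∣ x ∣ ℕ.* ℤ.∣ x ∣) ≡ x * x
square-abs x = trans (ℤ.pos-* ℤ.∣ x ∣ ℤ.∣ x ∣) (same-sign x)
  where
  same-sign : ∀ x → + ℤ.∣ x ∣ * + ℤ.∣ x ∣ ≡ x * x
  same-sign (+ n) = refl
  same-sign -[1+ n ] = refl

norm2⇒EightMPm1ᵍ : NormTwice⇒EightMPm1ᵍ 1
norm2⇒EightMPm1ᵍ z N≡2 = ∣x∣≡1⇒EightMPm1 (proj₁ ∣re∣,∣im∣≡1) , ∣x∣≡1⇒EightMPm1 (proj₂ ∣re∣,∣im∣≡1)
  where
  ∣re∣,∣im∣≡1 : ℤ.∣ re z ∣ ≡ 1 × ℤ.∣ im z ∣ ≡ 1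
  ∣re∣,∣im∣≡1 = m²+n²≡2⇒≡1 ℤ.∣ re z ∣ ℤ.∣ im z ∣ (ℤ.+-injective (begin
    + (∣x∣² ℕ.+ ∣y∣²)      ≡⟨ ℤ.pos-+ ∣x∣² ∣y∣² ⟩
    + ∣x∣² + + ∣y∣²        ≡⟨ cong₂ _+_ (square-abs (re z)) (square-abs (im z)) ⟩
    norm z                 ≡⟨ N≡2 ⟩
    + 2                    ∎))
    where
    ∣x∣² ∣y∣² : ℕ
    ∣x∣² = ℤ.∣ re z ∣ ℕ.* ℤ.∣ re z ∣
    ∣y∣² = ℤ.∣ im z ∣ ℕ.* ℤ.∣ im z ∣

p∣re[zπ̄]⇒EightMPm1ᵍ : ∀ {p M} π z → Prime p → + p ≡ norm π
                    → EightMPm1 (re π + im π) → EightMPm1 (re π - im π) → NormTwice⇒EightMPm1ᵍ M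
                    → norm z ≡ + (2 ℕ.* (p ℕ.* M)) → + p ∣ re (z *ᵍ conj π) → EightMPm1ᵍ z
p∣re[zπ̄]⇒EightMPm1ᵍ {p} {M} π z p-prime p≡Nπ a+b∈ a-b∈ forced Nz≡ p∣re =
  subst EightMPm1ᵍ (sym z≡wπ) (EightMPm1ᵍ-*ᵍ π (forced w Nw≡) a+b∈ a-b∈)
  where
  w : ℤ[i]
  w = proj₁ (prime-norm∣⇒∣ π z p-prime p≡Nπ p∣re)
  z≡wπ : z ≡ w *ᵍ π
  z≡wπ = proj₂ (prime-norm∣⇒∣ π z p-prime p≡Nπ p∣re)
  Nw≡ : norm w ≡ + (2 ℕ.* M)
  Nw≡ = ℤ.*-cancelʳ-≡ _ _ (+ p) {{prime⇒nonZero p-prime}} (begin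
    norm w * + p        ≡⟨ cong (norm w *_) p≡Nπ ⟩
    norm w * norm π     ≡⟨ sym (norm-*ᵍ w π) ⟩
    norm (w *ᵍ π)       ≡⟨ cong norm (sym z≡wπ) ⟩
    norm z              ≡⟨ Nz≡ ⟩
    + (2 ℕ.* (p ℕ.* M)) ≡⟨ +[2*[c*M]]≡+[2*M]*+c p M ⟩
    + (2 ℕ.* M) * + p   ∎)

-- re(z π̄) re(z π) = a² N(z) − im(z)² N(π) is divisible by p, so π or π̄ divides z.
split-prime-scales : ∀ {p} a b → Prime p → + p ≡ a * a + b * b → EightMPm1 (a + b) → EightMPm1 (a - b)
                   → ScalesBy NormTwice⇒EightMPm1ᵍ p
split-prime-scales {p} a b p-prime p≡Nπ a+b∈ a-b∈ M forced z Nz≡ =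
  [ p∣re[zπ̄]⇒EightMPm1ᵍ π z p-prime p≡Nπ a+b∈ a-b∈ forced Nz≡
  , p∣re[zπ̄]⇒EightMPm1ᵍ (conj π) z p-prime p≡Nπ̄ a-b∈ a+b∈′ forced Nz≡
    ∘ subst (λ ρ → + p ∣ re (z *ᵍ ρ)) (sym (conj-involutive π))
  ]′ (euclidsLemmaℤ p-prime (re (z *ᵍ conj π)) (re (z *ᵍ π)) p∣product)
  where
  π : ℤ[i]
  π = gauss a b
  p≡Nπ̄ : + p ≡ norm (conj π)
  p≡Nπ̄ = trans p≡Nπ (sym (norm-conj π))
  a+b∈′ : EightMPm1 (a - - b)
  a+b∈′ = subst EightMPm1 (cong (_+_ a) (sym (ℤ.neg-involutive b))) a+b∈
  p∣Nz : + p ∣ norm z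
  p∣Nz = subst (+ p ∣_) (sym Nz≡) (∣ᵤ⇒∣ (ℕ.∣n⇒∣m*n 2 (ℕ.m∣m*n M)))
  p∣product : + p ∣ re (z *ᵍ conj π) * re (z *ᵍ π)
  p∣product = subst (+ p ∣_) (sym (re-*ᵍ-conj-*-re-*ᵍ z π))
    (∣m∣n⇒∣m-n (∣n⇒∣m*n (a * a) p∣Nz) (∣n⇒∣m*n (im z * im z) (subst (+ p ∣_) p≡Nπ ∣-refl)))

%8≡7⇒≡8m-1 : ∀ q → q % 8 ≡ 7 → + q ≡ + 8 * (+ (q ℕ./ 8) + 1ℤ) - 1ℤ
%8≡7⇒≡8m-1 q q%8≡7 = begin
  + q                           ≡⟨ cong +_ (trans (m≡m%n+[m/n]*n q 8) (cong (ℕ._+ q ℕ./ 8 ℕ.* 8) q%8≡7)) ⟩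
  + (7 ℕ.+ q ℕ./ 8 ℕ.* 8)       ≡⟨ trans (ℤ.pos-+ 7 (q ℕ./ 8 ℕ.* 8)) (cong (_+_ (+ 7)) (ℤ.pos-* (q ℕ./ 8) 8)) ⟩
  + 7 + + (q ℕ./ 8) * + 8       ≡⟨ regroup (+ (q ℕ./ 8)) ⟩
  + 8 * (+ (q ℕ./ 8) + 1ℤ) - 1ℤ ∎
  where
  regroup : ∀ n → + 7 + n * + 8 ≡ + 8 * (n + 1ℤ) - 1ℤ
  regroup = solve-∀

inert-prime-scales : ∀ {q} → Prime q → q % 8 ≡ 7 → ScalesBy NormTwice⇒EightMPm1ᵍ (q ℕ.* q)
inert-prime-scales {q} q-prime q%8≡7 M forced z Nz≡ =
  subst EightMPm1ᵍ (sym z≡w·q) (times-q (proj₁ w∈) , times-q (proj₂ w∈))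
  where
  instance
    q≢0 : ℕ.NonZero q
    q≢0 = prime⇒nonZero q-prime
  q∣Nz : + q ∣ norm z
  q∣Nz = subst (+ q ∣_) (sym Nz≡) (∣ᵤ⇒∣ (ℕ.∣n⇒∣m*n 2 (ℕ.∣m⇒∣m*n M (ℕ.m∣m*n q))))
  q%4≡3 : q % 4 ≡ 3
  q%4≡3 = trans (sym (m∣n⇒o%n%m≡o%m 4 8 q (ℕ.divides 2 refl))) (cong (_% 4) q%8≡7)
  q∣re : + q ∣ re z
  q∣re = prime≡3mod4∣x²+y²⇒∣x q-prime q%4≡3 (re z) (im z) q∣Nz
  q∣im : + q ∣ im z
  q∣im = prime≡3mod4∣x²+y²⇒∣x q-prime q%4≡3 (im z) (re z) (subst (+ q ∣_) (ℤ.+-comm (re z * re z) _) q∣Nz)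
  w : ℤ[i]
  w = proj₁ (∣re∧∣im⇒·ᵍ q∣re q∣im)
  z≡w·q : z ≡ w ·ᵍ (+ q)
  z≡w·q = proj₂ (∣re∧∣im⇒·ᵍ q∣re q∣im)
  Nw≡ : norm w ≡ + (2 ℕ.* M)
  Nw≡ = ℤ.*-cancelʳ-≡ _ _ (+ (q ℕ.* q)) {{ℕ.m*n≢0 q q}} (begin
    norm w * + (q ℕ.* q)        ≡⟨ cong (norm w *_) (ℤ.pos-* q q) ⟩
    norm w * (+ q * + q)        ≡⟨ sym (norm-·ᵍ w (+ q)) ⟩
    norm (w ·ᵍ (+ q))           ≡⟨ cong norm (sym z≡w·q) ⟩
    norm z                      ≡⟨ Nz≡ ⟩
    + (2 ℕ.* (q ℕ.* q ℕ.* M))   ≡⟨ +[2*[c*M]]≡+[2*M]*+c (q ℕ.* q) M ⟩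
    + (2 ℕ.* M) * + (q ℕ.* q)   ∎)
  w∈ : EightMPm1ᵍ w
  w∈ = forced w Nw≡
  times-q : ∀ {u} → EightMPm1 u → EightMPm1 (u * + q)
  times-q {u} u∈ = subst (λ k → EightMPm1 (u * k)) (sym (%8≡7⇒≡8m-1 q q%8≡7))
                         (EightMPm1-*-[8m-1] (+ (q ℕ./ 8) + 1ℤ) u∈)

[m*m]^n≡m^[2*n] : ∀ m n → (m ℕ.* m) ^ n ≡ m ^ (2 ℕ.* n)
[m*m]^n≡m^[2*n] m n = trans (cong (λ t → (m ℕ.* t) ^ n) (sym (ℕ.*-identityʳ m))) (ℕ.^-*-assoc m 2 n)

lemma4p8 : (r s : ℕ)
    → (p : Fin r → ℕ) (a b : Fin r → ℤ)
    → (∀ i → Prime (p i))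
    → (∀ i → ℤ.+ (p i) ≡ (a i * a i) + (b i * b i))
    → (∀ i → p i % 8 ≡ 1)
    → (∀ i → EightMPm1 (a i + b i))
    → (∀ i → EightMPm1 (a i - b i))
    → (q : Fin s → ℕ)
    → (∀ j → Prime (q j))
    → (∀ j → q j % 8 ≡ 7)
    → (k : Fin r → ℕ) (l : Fin s → ℕ)
    → (α : ℤ[i])
    → α *ᵍ conj α ≡ fromℕ (2 ℕ.* (∏ r (λ i → p i ^ k i) ℕ.* ∏ s (λ j → q j ^ (2 ℕ.* l j))))
    → EightMPm1 (re α) × EightMPm1 (im α)
lemma4p8 r s p a b p-prime p≡a²+b² _ a+b∈ a-b∈ q q-prime q%8≡7 k l α αᾱ≡ =
  forced α (trans (sym (re-*ᵍ-conj α)) (cong re αᾱ≡))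
  where
  pᵏ : Fin r → ℕ
  pᵏ i = p i ^ k i
  q²ˡ : Fin s → ℕ
  q²ˡ j = q j ^ (2 ℕ.* l j)
  split-powers : ∀ i → ScalesBy NormTwice⇒EightMPm1ᵍ (pᵏ i)
  split-powers i = scalesBy-^ (split-prime-scales (a i) (b i) (p-prime i) (p≡a²+b² i) (a+b∈ i) (a-b∈ i)) (k i)
  inert-powers : ∀ j → ScalesBy NormTwice⇒EightMPm1ᵍ (q²ˡ j)
  inert-powers j = subst (ScalesBy NormTwice⇒EightMPm1ᵍ) ([m*m]^n≡m^[2*n] (q j) (l j))
    (scalesBy-^ (inert-prime-scales (q-prime j) (q%8≡7 j)) (l j))
  forced : NormTwice⇒EightMPm1ᵍ (∏ r pᵏ ℕ.* ∏ s q²ˡ)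
  forced = scalesBy-∏ r pᵏ split-powers (∏ s q²ˡ)
    (subst NormTwice⇒EightMPm1ᵍ (ℕ.*-identityʳ (∏ s q²ˡ)) (scalesBy-∏ s q²ˡ inert-powers 1 norm2⇒EightMPm1ᵍ))
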